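{- Let $G$ be a connected graph of order $r\ge 2$. Let $H$ be a connected graph of order $t\ge 2$ and let $v$ be a vertex of $H$ of degree $t-1$. Let $c(H-v)$ be the number of vertices of $H-v$ having degree $t-2$ in $H-v$. (i) If $H-v$ has no true twins, then $\dim_s(G\circ_v H)=r(t-1)-\omega(H-v)$. (ii) If the only true twins of $H-v$ are vertices of degree $t-2$, then $\dim_s(G\circ_v H)=r(t-1)+c(H-v)-1-\omega(H-v)$.
   Context: All graphs are finite and simple; $d$ denotes shortest-path distance. A vertex $w$ strongly resolves $u,x$ if $d(w,u)=d(w,x)+d(x,u)$ or $d(w,x)=d(w,u)+d(u,x)$. A strong metric generator of a connected graph $X$ is a set of vertices $S$ such that every pair of vertices is strongly resolved by some vertex of $S$; $\dim_s(X)$ is the minimum cardinality of such a set. Rooted product: for a graph $G$ with $V(G)=\{u_1,\dots,u_n\}$ and a graph $H$ with root $v$, $G\circ_v H$ has vertex set $V(G)\times V(H)$ and edge set $\bigcup_{i=1}^n\{(u_i,b)(u_i,y): by\in E(H)\}\cup\{(u_i,v)(u_j,v): u_iu_j\in E(G)\}$. $H-v$ is the graph obtained from $H$ by deleting $v$. Two distinct vertices $x,y$ are true twins if their closed neighbourhoods coincide, $N[x]=N[y]$. $\omega(F)$ denotes the clique number of $F$ (maximum number of vertices of a complete subgraph). -}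

module Defs where

open import Data.Nat using (ℕ; zero; suc; _+_; _≤_)
open import Data.Bool using (Bool; true; false; _∧_; _∨_; if_then_else_)
open import Data.Fin using (Fin; zero; suc; _≟_; remQuot; punchIn)
open import Data.Fin.Subset using (Subset; _∈_; ∣_∣)
open import Data.Product using (Σ; ∃; _×_; _,_)
open import Data.Sum using (_⊎_)
open import Relation.Nullary using (¬_)
open import Relation.Nullary.Decidable using (isYes)
open import Relation.Binary.PropositionalEquality using (_≡_; _≢_)

Graph : ℕ → Set
Graph n = Fin n → Fin n → Bool

IsSimple : {n : ℕ} → Graph n → Set
IsSimple {n} A = (∀ x y → A x y ≡ A y x) × (∀ x → A x x ≡ false)

anyFin : {n : ℕ} → (Fin n → Bool) → Bool
anyFin {zero}  p = false
anyFin {suc n} p = p zero ∨ anyFin (λ i → p (suc i))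

countFin : {n : ℕ} → (Fin n → Bool) → ℕ
countFin {zero}  p = 0
countFin {suc n} p = (if p zero then 1 else 0) + countFin (λ i → p (suc i))

reach : {n : ℕ} → Graph n → ℕ → Fin n → Fin n → Bool
reach A zero    u w = isYes (u ≟ w)
reach A (suc k) u w = anyFin (λ y → A u y ∧ reach A k y w)

Connected : {n : ℕ} → Graph n → Set
Connected A = ∀ u w → ∃ λ k → reach A k u w ≡ true

-- least k ≤ N with p k (N if none)
least : (ℕ → Bool) → ℕ → ℕ
least p zero    = zero
least p (suc N) = if p zero then zero else suc (least (λ k → p (suc k)) N)

-- shortest-path distance (length of a shortest walk; in a connected graph
-- on n vertices it is < n, so searching up to n suffices)
dist : {n : ℕ} → Graph n → Fin n → Fin n → ℕ
dist {n} A u w = least (λ k → reach A k u w) n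

degree : {n : ℕ} → Graph n → Fin n → ℕ
degree A x = countFin (A x)

StronglyResolves : {n : ℕ} → Graph n → Fin n → Fin n → Fin n → Set
StronglyResolves A w u x =
  (dist A w u ≡ dist A w x + dist A x u) ⊎ (dist A w x ≡ dist A w u + dist A u x)

IsStrongMetricGenerator : {n : ℕ} → Graph n → Subset n → Set
IsStrongMetricGenerator {n} A S =
  ∀ (u x : Fin n) → u ≢ x → ∃ λ w → (w ∈ S) × StronglyResolves A w u x

IsStrongMetricDim : {n : ℕ} → Graph n → ℕ → Set
IsStrongMetricDim {n} A m =
  (∃ λ (S : Subset n) → IsStrongMetricGenerator A S × ∣ S ∣ ≡ m)
  × (∀ (S : Subset n) → IsStrongMetricGenerator A S → m ≤ ∣ S ∣)

IsClique : {n : ℕ} → Graph n → Subset n → Set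
IsClique A S = ∀ x y → x ∈ S → y ∈ S → x ≢ y → A x y ≡ true

IsCliqueNumber : {n : ℕ} → Graph n → ℕ → Set
IsCliqueNumber {n} A k =
  (∃ λ (S : Subset n) → IsClique A S × ∣ S ∣ ≡ k)
  × (∀ (S : Subset n) → IsClique A S → ∣ S ∣ ≤ k)

closedNbr : {n : ℕ} → Graph n → Fin n → Fin n → Bool
closedNbr A x z = isYes (x ≟ z) ∨ A x z

TrueTwins : {n : ℕ} → Graph n → Fin n → Fin n → Set
TrueTwins A x y = x ≢ y × (∀ z → closedNbr A x z ≡ closedNbr A y z)

-- Rooted product G ∘_v H; vertex (u_i , b) is encoded as combine i b : Fin (r * t).
rootedProduct : {r t : ℕ} → Graph r → Graph t → Fin t → Graph (r Data.Nat.* t)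
rootedProduct {r} {t} G H v p q with remQuot {r} t p | remQuot {r} t q
... | (i , b) | (j , y) =
  (isYes (i ≟ j) ∧ H b y) ∨ (isYes (b ≟ v) ∧ isYes (y ≟ v) ∧ G i j)

-- H - v, with vertices of H other than v enumerated by punchIn v.
deleteVertex : {t : ℕ} → Graph (suc t) → Fin (suc t) → Graph t
deleteVertex H v a b = H (punchIn v a) (punchIn v b)

numWithDegree : {n : ℕ} → Graph n → ℕ → ℕ
numWithDegree F d = countFin (λ x → isYes (degree F x Data.Nat.≟ d))

-- In G ∘ᵥ H a non-root vertex (i , b) reaches everything outside its copy of H
-- through the root (i , v), and two non-root vertices of one copy are at distance
-- 1 or 2. Hence two non-root vertices are mutually maximally distant when they lie
-- in different copies, are non-adjacent, or are true twins of H - v; such a pair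
-- is strongly resolved only by its own members. So a strong metric generator
-- misses, apart from the roots, at most a twin-free clique of H - v inside a
-- single copy. Conversely, dropping the roots and one twin-free clique K in one
-- copy leaves a strong metric generator, since two vertices of K are separated by
-- a private neighbour, which lies outside K. Thus dim_s = r(t - 1) - τ with τ the
-- largest twin-free clique of H - v. Without twins τ = ω; if the only twins are
-- the c vertices of full degree in H - v, these lie in every maximum clique and
-- keeping just one of them gives τ = ω - c + 1.

module Submission where

open import Defs
open import Data.Bool as Bool using (Bool; true; false; _∧_; _∨_; not; if_then_else_)
open import Data.Empty using (⊥; ⊥-elim)
open import Data.Fin as Fin using (Fin; zero; suc; _≟_; punchIn; punchOut; combine; remQuot; _↑ˡ_; _↑ʳ_)
open import Data.Fin.Properties
  using (remQuot-combine; combine-remQuot; combine-injectiveˡ; combine-injectiveʳ;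
         punchIn-injective; punchInᵢ≢i; punchIn-punchOut; pigeonhole; ¬∀⟶∃¬; toℕ<n)
  renaming (suc-injective to Fin-suc-injective)
open import Data.Fin.Subset using (Subset; _∈_; _∉_; ∣_∣; Empty)
open import Data.Fin.Subset.Properties using (nonempty?; Empty-unique; ∣⊥∣≡0)
open import Data.Nat as ℕ using (ℕ; zero; suc; _+_; _*_; _∸_; _≤_; _<_; z≤n; s≤s; z<s; s<s; s<s⁻¹; s≤s⁻¹)
open import Data.Nat.Properties hiding (_≟_)
open import Data.Product using (Σ; ∃; _×_; _,_; proj₁; proj₂; uncurry)
open import Data.Sum using (_⊎_; inj₁; inj₂; [_,_]′)
open import Data.List using (List; []; _∷_; length)
import Data.List as List
open import Data.List.Membership.Propositional using () renaming (_∈_ to _∈ᴸ_)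
open import Data.List.Membership.Propositional.Properties using (∈-lookup)
open import Data.List.Relation.Unary.All as All using ([]; _∷_)
open import Data.List.Relation.Unary.All.Properties using (¬Any⇒All¬)
open import Data.List.Relation.Unary.Any using (here; there)
open import Data.List.Relation.Unary.AllPairs using ([]; _∷_)
open import Data.List.Relation.Unary.Unique.Propositional using (Unique)
open import Data.Vec using ([]; _∷_; lookup; tabulate)
open import Data.Vec.Properties using ([]=⇒lookup; lookup⇒[]=; lookup∘tabulate)
open import Relation.Binary.PropositionalEquality
open import Relation.Nullary using (¬_; Dec; yes; no; contradiction)
open import Relation.Nullary.Decidable using (isYes)
open import Function using (_∘_)
open import Algebra.Properties.CommutativeMonoid.Sum +-0-commutativeMonoid
  using (sum; sum-cong-≗; ∑-distrib-+)
open import Data.Bool.Properties using (∧-commutativeMonoid; ∧-identityʳ; ∧-zeroʳ; ¬-not)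
open import Algebra.Bundles using (CommutativeMonoid)
open import Algebra.Properties.CommutativeSemigroup (CommutativeMonoid.commutativeSemigroup ∧-commutativeMonoid)
  using () renaming (x∙yz≈y∙xz to x∧[y∧z]≡y∧[x∧z])
open import Algebra.Properties.CommutativeSemigroup +-commutativeSemigroup
  using () renaming (interchange to +-interchange; x∙yz≈y∙xz to x+[y+z]≡y+[x+z]; xy∙z≈xz∙y to [x+y]+z≡[x+z]+y)

isYes-true : ∀ {A : Set} (a? : Dec A) → A → isYes a? ≡ true
isYes-true (yes _) _ = refl
isYes-true (no ¬a) a = contradiction a ¬a

isYes-false : ∀ {A : Set} (a? : Dec A) → ¬ A → isYes a? ≡ false
isYes-false (yes a) ¬a = contradiction a ¬a
isYes-false (no _)  _  = refl

isYes-sound : ∀ {A : Set} (a? : Dec A) → isYes a? ≡ true → A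
isYes-sound (yes a) _ = a

isYes-≟-sym : ∀ {n} (a b : Fin n) → isYes (a ≟ b) ≡ isYes (b ≟ a)
isYes-≟-sym a b with a ≟ b
... | yes refl = sym (isYes-true (a ≟ a) refl)
... | no a≢b   = sym (isYes-false (b ≟ a) (a≢b ∘ sym))

∨-true⁻ : ∀ {a b} → a ∨ b ≡ true → a ≡ true ⊎ b ≡ true
∨-true⁻ {true}  _ = inj₁ refl
∨-true⁻ {false} e = inj₂ e

∧-true⁻ : ∀ {a b} → a ∧ b ≡ true → a ≡ true × b ≡ true
∧-true⁻ {true} e = refl , e

∨-trueˡ : ∀ {a} b → a ≡ true → a ∨ b ≡ true
∨-trueˡ b refl = refl

∨-trueʳ : ∀ a {b} → b ≡ true → a ∨ b ≡ true
∨-trueʳ true  _ = refl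
∨-trueʳ false e = e

∈⇒lookup : ∀ {n} {S : Subset n} {i} → i ∈ S → lookup S i ≡ true
∈⇒lookup = []=⇒lookup

lookup⇒∈ : ∀ {n} {S : Subset n} {i} → lookup S i ≡ true → i ∈ S
lookup⇒∈ = lookup⇒[]= _ _

∈tabulate⁻ : ∀ {n} {p : Fin n → Bool} {i} → i ∈ tabulate p → p i ≡ true
∈tabulate⁻ {p = p} {i} m = trans (sym (lookup∘tabulate p i)) (∈⇒lookup m)

anyFin-sound : ∀ {n} (p : Fin n → Bool) → anyFin p ≡ true → ∃ λ i → p i ≡ true
anyFin-sound {suc n} p e with ∨-true⁻ {p zero} e
... | inj₁ p0 = zero , p0
... | inj₂ ps with anyFin-sound (λ i → p (suc i)) ps
...   | i , pi = suc i , pi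

anyFin-complete : ∀ {n} (p : Fin n → Bool) i → p i ≡ true → anyFin p ≡ true
anyFin-complete p zero    e = ∨-trueˡ _ e
anyFin-complete p (suc i) e = ∨-trueʳ (p zero) (anyFin-complete (λ i → p (suc i)) i e)

image : ∀ {m n} → (Fin m → Fin n) → (Fin m → Bool) → Fin n → Bool
image f p b = anyFin (λ a → p a ∧ isYes (f a ≟ b))

image-sound : ∀ {m n} (f : Fin m → Fin n) p {b} → image f p b ≡ true → ∃ λ a → p a ≡ true × f a ≡ b
image-sound f p {b} e with a , pa∧fa≡b ← anyFin-sound (λ a → p a ∧ isYes (f a ≟ b)) e
  with pa , fa≡b ← ∧-true⁻ pa∧fa≡b = a , pa , isYes-sound (f a ≟ b) fa≡b

image-at : ∀ {m n} {f : Fin m → Fin n} (p : Fin m → Bool) → (∀ {a a′} → f a ≡ f a′ → a ≡ a′) →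
  ∀ a → image f p (f a) ≡ p a
image-at {f = f} p f-injective a with p a in pa
... | true  = anyFin-complete (λ a′ → p a′ ∧ isYes (f a′ ≟ f a)) a (cong₂ _∧_ pa (isYes-true (f a ≟ f a) refl))
... | false with image f p (f a) in img
...   | false = refl
...   | true with a′ , pa′ , fa′≡fa ← image-sound f p img =
  contradiction (trans (sym pa) (subst (λ x → p x ≡ true) (f-injective fa′≡fa) pa′)) λ ()

𝟙 : Bool → ℕ
𝟙 b = if b then 1 else 0

countFin-cong : ∀ {n} {p q : Fin n → Bool} → (∀ i → p i ≡ q i) → countFin p ≡ countFin q
countFin-cong {zero}  e = refl
countFin-cong {suc n} e = cong₂ _+_ (cong 𝟙 (e zero)) (countFin-cong (λ i → e (suc i)))

countFin≤n : ∀ {n} (p : Fin n → Bool) → countFin p ≤ n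
countFin≤n {zero}  p = z≤n
countFin≤n {suc n} p with p zero
... | true  = s≤s (countFin≤n (λ i → p (suc i)))
... | false = m≤n⇒m≤1+n (countFin≤n (λ i → p (suc i)))

countFin-false : ∀ {n} (p : Fin n → Bool) → (∀ i → p i ≡ false) → countFin p ≡ 0
countFin-false {zero}  p h = refl
countFin-false {suc n} p h rewrite h zero = countFin-false _ (λ i → h (suc i))

countFin≡n⇒true : ∀ {n} (p : Fin n → Bool) → countFin p ≡ n → ∀ i → p i ≡ true
countFin≡n⇒true {suc n} p e i with p zero in p0
countFin≡n⇒true {suc n} p e zero    | true = p0
countFin≡n⇒true {suc n} p e (suc i) | true = countFin≡n⇒true (λ i → p (suc i)) (suc-injective e) i
countFin≡n⇒true {suc n} p e i | false =
  contradiction (≤-reflexive (sym e)) (<⇒≱ (s≤s (countFin≤n (λ i → p (suc i)))))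

countFin≤1 : ∀ {n} (p : Fin n → Bool) → (∀ i j → p i ≡ true → p j ≡ true → i ≡ j) → countFin p ≤ 1
countFin≤1 {zero}  p h = z≤n
countFin≤1 {suc n} p h with p zero in p0
... | true  = s≤s (≤-reflexive (countFin-false _ rest))
  where
    rest : ∀ i → p (suc i) ≡ false
    rest i with p (suc i) in pi
    ... | false = refl
    ... | true  with () ← h zero (suc i) p0 pi
... | false = countFin≤1 (λ i → p (suc i)) (λ i j pi pj → Fin-suc-injective (h (suc i) (suc j) pi pj))

𝟙-∨-∧ : ∀ a b → 𝟙 (a ∨ b) + 𝟙 (a ∧ b) ≡ 𝟙 a + 𝟙 b
𝟙-∨-∧ true  true  = refl
𝟙-∨-∧ true  false = refl
𝟙-∨-∧ false true  = refl
𝟙-∨-∧ false false = refl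

countFin-∨-∧ : ∀ {n} (p q : Fin n → Bool) →
  countFin (λ i → p i ∨ q i) + countFin (λ i → p i ∧ q i) ≡ countFin p + countFin q
countFin-∨-∧ {zero}  p q = refl
countFin-∨-∧ {suc n} p q = begin
  (a∨b + X) + (a∧b + Y) ≡⟨ +-interchange a∨b X a∧b Y ⟩
  (a∨b + a∧b) + (X + Y) ≡⟨ cong₂ _+_ (𝟙-∨-∧ (p zero) (q zero)) (countFin-∨-∧ (λ i → p (suc i)) (λ i → q (suc i))) ⟩
  (𝟙 (p zero) + 𝟙 (q zero)) + (P + Q) ≡⟨ +-interchange (𝟙 (p zero)) (𝟙 (q zero)) P Q ⟩
  (𝟙 (p zero) + P) + (𝟙 (q zero) + Q) ∎
  where
    open ≡-Reasoning
    a∨b a∧b X Y P Q : ℕ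
    a∨b = 𝟙 (p zero ∨ q zero)
    a∧b = 𝟙 (p zero ∧ q zero)
    X = countFin (λ i → p (suc i) ∨ q (suc i))
    Y = countFin (λ i → p (suc i) ∧ q (suc i))
    P = countFin (λ i → p (suc i))
    Q = countFin (λ i → q (suc i))

countFin-disjoint-∨ : ∀ {n} (p q : Fin n → Bool) → (∀ i → (p i ∧ q i) ≡ false) →
  countFin (λ i → p i ∨ q i) ≡ countFin p + countFin q
countFin-disjoint-∨ p q disj = begin
  countFin (λ i → p i ∨ q i)                                ≡⟨ +-identityʳ _ ⟨
  countFin (λ i → p i ∨ q i) + 0                            ≡⟨ cong (countFin (λ i → p i ∨ q i) +_) (countFin-false _ disj) ⟨
  countFin (λ i → p i ∨ q i) + countFin (λ i → p i ∧ q i)   ≡⟨ countFin-∨-∧ p q ⟩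
  countFin p + countFin q                                   ∎
  where open ≡-Reasoning

countFin-split : ∀ {n} (p q : Fin n → Bool) →
  countFin p ≡ countFin (λ i → p i ∧ q i) + countFin (λ i → p i ∧ not (q i))
countFin-split p q = trans (countFin-cong split) (countFin-disjoint-∨ _ _ disjoint)
  where
    split : ∀ i → p i ≡ (p i ∧ q i) ∨ (p i ∧ not (q i))
    split i with p i | q i
    ... | true  | true  = refl
    ... | true  | false = refl
    ... | false | _     = refl
    disjoint : ∀ i → ((p i ∧ q i) ∧ (p i ∧ not (q i))) ≡ false
    disjoint i with p i | q i
    ... | true  | true  = refl
    ... | true  | false = refl
    ... | false | _     = refl

countFin-not : ∀ {n} (p : Fin n → Bool) → countFin p + countFin (λ i → not (p i)) ≡ n
countFin-not {zero}  p = refl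
countFin-not {suc n} p with p zero
... | true  = cong suc (countFin-not (λ i → p (suc i)))
... | false = trans (+-suc _ _) (cong suc (countFin-not (λ i → p (suc i))))

countFin-punchIn : ∀ {n} (p : Fin (suc n) → Bool) v →
  countFin p ≡ 𝟙 (p v) + countFin (λ a → p (punchIn v a))
countFin-punchIn p zero = refl
countFin-punchIn {suc n} p (suc v) = begin
  𝟙 (p zero) + countFin (λ i → p (suc i))                                 ≡⟨ cong (𝟙 (p zero) +_) (countFin-punchIn (λ i → p (suc i)) v) ⟩
  𝟙 (p zero) + (𝟙 (p (suc v)) + countFin (λ a → p (suc (punchIn v a))))  ≡⟨ x+[y+z]≡y+[x+z] (𝟙 (p zero)) (𝟙 (p (suc v))) _ ⟩
  𝟙 (p (suc v)) + (𝟙 (p zero) + countFin (λ a → p (suc (punchIn v a))))  ∎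
  where open ≡-Reasoning

countFin-≟ : ∀ {n} (i : Fin n) → countFin (λ j → isYes (i ≟ j)) ≡ 1
countFin-≟ {suc n} i = begin
  countFin (λ j → isYes (i ≟ j))                                        ≡⟨ countFin-punchIn (λ j → isYes (i ≟ j)) i ⟩
  𝟙 (isYes (i ≟ i)) + countFin (λ a → isYes (i ≟ punchIn i a))          ≡⟨ cong₂ _+_ (cong 𝟙 (isYes-true (i ≟ i) refl)) (countFin-false _ off) ⟩
  1                                                                       ∎
  where
    open ≡-Reasoning
    off : ∀ a → isYes (i ≟ punchIn i a) ≡ false
    off a = isYes-false (i ≟ punchIn i a) (λ e → punchInᵢ≢i i a (sym e))

∣S∣≡countFin : ∀ {n} (S : Subset n) → ∣ S ∣ ≡ countFin (lookup S)
∣S∣≡countFin []          = refl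
∣S∣≡countFin (true ∷ S)  = cong suc (∣S∣≡countFin S)
∣S∣≡countFin (false ∷ S) = ∣S∣≡countFin S

∣tabulate∣≡countFin : ∀ {n} (p : Fin n → Bool) → ∣ tabulate p ∣ ≡ countFin p
∣tabulate∣≡countFin p = trans (∣S∣≡countFin (tabulate p)) (countFin-cong (lookup∘tabulate p))

∑-const : ∀ r c → sum {r} (λ _ → c) ≡ r * c
∑-const zero    c = refl
∑-const (suc r) c = cong (c +_) (∑-const r c)

∑-mono-≤ : ∀ {r} {f g : Fin r → ℕ} → (∀ i → f i ≤ g i) → sum f ≤ sum g
∑-mono-≤ {zero}  le = z≤n
∑-mono-≤ {suc r} le = +-mono-≤ (le zero) (∑-mono-≤ (λ i → le (suc i)))

∑-concentrated : ∀ {r} (f : Fin r → ℕ) i₀ → (∀ i → i ≢ i₀ → f i ≡ 0) → sum f ≡ f i₀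
∑-concentrated {suc r} f zero off = begin
  f zero + sum (λ i → f (suc i))   ≡⟨ cong (f zero +_) (trans (sum-cong-≗ (λ i → off (suc i) λ ())) (∑-const r 0)) ⟩
  f zero + r * 0                   ≡⟨ cong (f zero +_) (*-zeroʳ r) ⟩
  f zero + 0                       ≡⟨ +-identityʳ _ ⟩
  f zero                           ∎
  where open ≡-Reasoning
∑-concentrated {suc r} f (suc i₀) off rewrite off zero (λ ()) =
  ∑-concentrated (λ i → f (suc i)) i₀ (λ i i≢i₀ → off (suc i) (i≢i₀ ∘ Fin-suc-injective))

∑-≤-sparse : ∀ {r} (f : Fin r → ℕ) {B} → (∀ i → f i ≤ B) →
  (∀ i j → i ≢ j → f i ≡ 0 ⊎ f j ≡ 0) → sum f ≤ B
∑-≤-sparse {zero}  f bound sparse = z≤n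
∑-≤-sparse {suc r} f {B} bound sparse with f zero ℕ.≟ 0
... | yes f₀≡0 = subst (_≤ B) (cong (_+ sum (λ i → f (suc i))) (sym f₀≡0))
  (∑-≤-sparse (λ i → f (suc i)) (λ i → bound (suc i)) (λ i j i≢j → sparse (suc i) (suc j) (i≢j ∘ Fin-suc-injective)))
... | no f₀≢0 = subst (_≤ B) (sym (∑-concentrated f zero off)) (bound zero)
  where
    off : ∀ i → i ≢ zero → f i ≡ 0
    off zero    0≢0 = contradiction refl 0≢0
    off (suc i) _ with sparse zero (suc i) (λ ())
    ... | inj₁ f₀≡0 = contradiction f₀≡0 f₀≢0
    ... | inj₂ fᵢ≡0 = fᵢ≡0

countFin-↑ : ∀ m k (p : Fin (m + k) → Bool) →
  countFin p ≡ countFin (λ i → p (i ↑ˡ k)) + countFin (λ i → p (m ↑ʳ i))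
countFin-↑ zero    k p = refl
countFin-↑ (suc m) k p = trans (cong (𝟙 (p zero) +_) (countFin-↑ m k (λ i → p (suc i)))) (sym (+-assoc (𝟙 (p zero)) _ _))

countFin-combine : ∀ r t (p : Fin (r * t) → Bool) → countFin p ≡ sum (λ i → countFin (λ b → p (combine {r} {t} i b)))
countFin-combine zero    t p = refl
countFin-combine (suc r) t p =
  trans (countFin-↑ t (r * t) p) (cong (countFin (λ i → p (i ↑ˡ (r * t))) +_) (countFin-combine r t (λ i → p (t ↑ʳ i))))

empty⇒∣∣≡0 : ∀ {n} {C : Subset n} → Empty C → ∣ C ∣ ≡ 0
empty⇒∣∣≡0 {n} ¬∃a = trans (cong ∣_∣ (Empty-unique ¬∃a)) (∣⊥∣≡0 n)

-- Walks and distances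

least-minimal : ∀ p N k → p k ≡ true → least p N ≤ k
least-minimal p zero    k       pk = z≤n
least-minimal p (suc N) zero    pk rewrite pk = z≤n
least-minimal p (suc N) (suc k) pk with p zero
... | true  = z≤n
... | false = s≤s (least-minimal (λ k → p (suc k)) N k pk)

least-holds : ∀ p N → least p N < N → p (least p N) ≡ true
least-holds p (suc N) lt with p zero in p0
... | true  = p0
... | false = least-holds (λ k → p (suc k)) N (s<s⁻¹ lt)

module _ {n : ℕ} (A : Graph n) where

  infixr 5 _∷_
  data Walk : ℕ → Fin n → Fin n → Set where
    []  : ∀ {u} → Walk 0 u u
    _∷_ : ∀ {k u y w} → A u y ≡ true → Walk k y w → Walk (suc k) u w

  reach⇒Walk : ∀ k {u w} → reach A k u w ≡ true → Walk k u w
  reach⇒Walk zero    e with refl ← isYes-sound (_ ≟ _) e = []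
  reach⇒Walk (suc k) {u} {w} e with anyFin-sound (λ y → A u y ∧ reach A k y w) e
  ... | y , uy∧yw = proj₁ (∧-true⁻ uy∧yw) ∷ reach⇒Walk k (proj₂ (∧-true⁻ uy∧yw))

  Walk⇒reach : ∀ {k u w} → Walk k u w → reach A k u w ≡ true
  Walk⇒reach {u = u} []           = isYes-true (u ≟ u) refl
  Walk⇒reach {suc k} {u} {w} (_∷_ {y = y} uy p) =
    anyFin-complete (λ z → A u z ∧ reach A k z w) y (cong₂ _∧_ uy (Walk⇒reach p))

module _ {n : ℕ} {A : Graph n} where

  _++ᵂ_ : ∀ {k l u y w} → Walk A k u y → Walk A l y w → Walk A (k + l) u w
  []       ++ᵂ q = q
  (e ∷ p)  ++ᵂ q = e ∷ (p ++ᵂ q)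

module _ {n : ℕ} (A : Graph n) where

  open import Data.List.Membership.DecPropositional (_≟_ {n = n}) using () renaming (_∈?_ to _∈ᴸ?_)

  dist≤length : ∀ {k u w} → Walk A k u w → dist A u w ≤ k
  dist≤length {k} {u} {w} p = least-minimal (λ k → reach A k u w) n k (Walk⇒reach A p)

  geodesic : ∀ {u w} → dist A u w < n → Walk A (dist A u w) u w
  geodesic {u} {w} lt = reach⇒Walk A _ (least-holds (λ k → reach A k u w) n lt)

  dist-refl : ∀ u → dist A u u ≡ 0
  dist-refl u = n≤0⇒n≡0 (dist≤length ([] {u = u}))

  dist≡0⇒≡ : ∀ {u w} → dist A u w ≡ 0 → u ≡ w
  dist≡0⇒≡ {u} {w} d≡0 = walk₀⇒≡ (subst (λ k → Walk A k u w) d≡0 (geodesic (subst (_< n) (sym d≡0) 0<n)))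
    where
      0<n : 0 < n
      0<n = ≤-<-trans z≤n (toℕ<n u)
      walk₀⇒≡ : Walk A 0 u w → u ≡ w
      walk₀⇒≡ [] = refl

  dist-edge : ∀ {u w} → A u w ≡ true → u ≢ w → dist A u w ≡ 1
  dist-edge {u} {w} uw u≢w with dist A u w in d | dist≤length (uw ∷ [])
  ... | zero        | _      = contradiction (dist≡0⇒≡ d) u≢w
  ... | suc zero    | _      = refl
  ... | suc (suc _) | s≤s ()

  vertices : ∀ {k u w} → Walk A k u w → List (Fin n)
  vertices {u = u} []      = u ∷ []
  vertices {u = u} (_ ∷ p) = u ∷ vertices p

  length-vertices : ∀ {k u w} (p : Walk A k u w) → length (vertices p) ≡ suc k
  length-vertices []      = refl
  length-vertices (_ ∷ p) = cong suc (length-vertices p)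

  Path : Fin n → Fin n → Set
  Path u w = Σ ℕ λ k → Σ (Walk A k u w) λ p → Unique (vertices p)

  path-from : ∀ {k y w x} (p : Walk A k y w) → Unique (vertices p) → x ∈ᴸ vertices p → Path x w
  path-from []      uq       (here refl) = _ , [] , uq
  path-from (e ∷ p) uq       (here refl) = _ , e ∷ p , uq
  path-from (e ∷ p) (_ ∷ uq) (there x∈p) = path-from p uq x∈p

  walk⇒path : ∀ {k u w} → Walk A k u w → Path u w
  walk⇒path []                = 0 , [] , [] ∷ []
  walk⇒path {u = u} (e ∷ p) with walk⇒path p
  ... | k , q , uq with u ∈ᴸ? vertices q
  ... | yes u∈q = path-from q uq u∈q
  ... | no  u∉q = suc k , e ∷ q , ¬Any⇒All¬ (vertices q) u∉q ∷ uq

  Unique⇒length≤ : ∀ {xs : List (Fin n)} → Unique xs → length xs ≤ n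
  Unique⇒length≤ {xs} uq with n <? length xs
  ... | no  n≮len = ≮⇒≥ n≮len
  ... | yes n<len with i , j , i<j , xsᵢ≡xsⱼ ← pigeonhole n<len (List.lookup xs) =
    contradiction xsᵢ≡xsⱼ (lookup-distinct uq i<j)
    where
      lookup-distinct : ∀ {ys : List (Fin n)} → Unique ys → ∀ {i j} → i Fin.< j → List.lookup ys i ≢ List.lookup ys j
      lookup-distinct (y∉ys ∷ _)  {zero}  {suc j} _         = All.lookup y∉ys (∈-lookup j)
      lookup-distinct (_ ∷ uq)    {suc i} {suc j} (s<s i<j) = lookup-distinct uq i<j

  connected⇒dist<n : Connected A → ∀ u w → dist A u w < n
  connected⇒dist<n conn u w with conn u w
  ... | k , r with walk⇒path (reach⇒Walk A k r)
  ... | l , p , uq = begin-strict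
    dist A u w               ≤⟨ dist≤length p ⟩
    l                        <⟨ n<1+n l ⟩
    suc l                    ≡⟨ length-vertices p ⟨
    length (vertices p)      ≤⟨ Unique⇒length≤ uq ⟩
    n                        ∎
    where open ≤-Reasoning

  resolves-selfˡ : ∀ u x → StronglyResolves A u u x
  resolves-selfˡ u x = inj₂ (cong (_+ dist A u x) (sym (dist-refl u)))

  resolves-selfʳ : ∀ u x → StronglyResolves A x u x
  resolves-selfʳ u x = inj₁ (cong (_+ dist A x u) (sym (dist-refl x)))

  resolves-sym : ∀ {w u x} → StronglyResolves A w u x → StronglyResolves A w x u
  resolves-sym (inj₁ e) = inj₂ e
  resolves-sym (inj₂ e) = inj₁ e

MaximallyDistant : ∀ {n} → Graph n → Fin n → Fin n → Set
MaximallyDistant A x u = ∀ z → A x z ≡ true → dist A z u ≤ dist A x u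

MutuallyMaximallyDistant : ∀ {n} → Graph n → Fin n → Fin n → Set
MutuallyMaximallyDistant A u x = MaximallyDistant A x u × MaximallyDistant A u x

module Metric {n : ℕ} (A : Graph n) (A-sym : ∀ x y → A x y ≡ A y x) (A-connected : Connected A) where

  d : Fin n → Fin n → ℕ
  d = dist A

  shortest : ∀ u w → Walk A (d u w) u w
  shortest u w = geodesic A (connected⇒dist<n A A-connected u w)

  snoc : ∀ {k u y w} → Walk A k u y → A y w ≡ true → Walk A (suc k) u w
  snoc []      e = e ∷ []
  snoc (e′ ∷ p) e = e′ ∷ snoc p e

  reverse : ∀ {k u w} → Walk A k u w → Walk A k w u
  reverse []                          = []
  reverse (_∷_ {u = u} {y = y} e p) = snoc (reverse p) (trans (A-sym y u) e)

  dist-sym : ∀ u w → d u w ≡ d w u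
  dist-sym u w = ≤-antisym (dist≤length A (reverse (shortest w u))) (dist≤length A (reverse (shortest u w)))

  dist-triangle : ∀ u y w → d u w ≤ d u y + d y w
  dist-triangle u y w = dist≤length A (shortest u y ++ᵂ shortest y w)

  shortest-step : ∀ {u w k} → d u w ≡ suc k → ∃ λ z → A u z ≡ true × d z w ≡ k
  shortest-step {u} {w} {k} d≡ = first-step (subst (λ m → Walk A m u w) d≡ (shortest u w))
    where
      first-step : Walk A (suc k) u w → ∃ λ z → A u z ≡ true × d z w ≡ k
      first-step (_∷_ {y = z} uz p) =
        z , uz , ≤-antisym (dist≤length A p) (s≤s⁻¹ (subst (_≤ suc (d z w)) d≡ (dist≤length A (uz ∷ shortest z w))))

  -- If x ≠ w lay on a shortest w–u path, the neighbour of x towards w would be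
  -- no farther from u than x is, giving a shorter w–u path.
  beyond-maximallyDistant : ∀ {w u x} → MaximallyDistant A x u → d w u ≡ d w x + d x u → w ≡ x
  beyond-maximallyDistant {w} {u} {x} x-max eq with d x w in dxw
  ... | zero  = sym (dist≡0⇒≡ A dxw)
  ... | suc k with z , xz , dzw ← shortest-step dxw = contradiction d<d (<-irrefl refl)
    where
      open ≤-Reasoning
      d<d : d w u < d w u
      d<d = begin-strict
        d w u          ≤⟨ dist-triangle w z u ⟩
        d w z + d z u  ≡⟨ cong (_+ d z u) (trans (dist-sym w z) dzw) ⟩
        k + d z u      ≤⟨ +-monoʳ-≤ k (x-max z xz) ⟩
        k + d x u      <⟨ n<1+n _ ⟩
        suc k + d x u  ≡⟨ cong (_+ d x u) (trans (sym dxw) (dist-sym x w)) ⟩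
        d w x + d x u  ≡⟨ eq ⟨
        d w u          ∎

  dist≡1⇒edge : ∀ {u w} → d u w ≡ 1 → A u w ≡ true
  dist≡1⇒edge {u} {w} d≡1 with z , uz , dzw ← shortest-step d≡1 with refl ← dist≡0⇒≡ A dzw = uz

  resolver-of-mutuallyMaximallyDistant : ∀ {w u x} → MutuallyMaximallyDistant A u x →
    StronglyResolves A w u x → w ≡ u ⊎ w ≡ x
  resolver-of-mutuallyMaximallyDistant (x-max , u-max) (inj₁ eq) = inj₂ (beyond-maximallyDistant x-max eq)
  resolver-of-mutuallyMaximallyDistant (x-max , u-max) (inj₂ eq) = inj₁ (beyond-maximallyDistant u-max eq)

  generator-meets-mutuallyMaximallyDistant : ∀ {S u x} → IsStrongMetricGenerator A S → u ≢ x →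
    MutuallyMaximallyDistant A u x → u ∈ S ⊎ x ∈ S
  generator-meets-mutuallyMaximallyDistant {S} {u} {x} gen u≢x mmd
    with w , w∈S , w-res ← gen u x u≢x
    with resolver-of-mutuallyMaximallyDistant mmd w-res
  ... | inj₁ refl = inj₁ w∈S
  ... | inj₂ refl = inj₂ w∈S

Universal : ∀ {n} → Graph n → Fin n → Set
Universal A a = ∀ b → b ≢ a → A a b ≡ true

TwinFree : ∀ {n} → Graph n → Subset n → Set
TwinFree F C = ∀ a a′ → a ∈ C → a′ ∈ C → ¬ TrueTwins F a a′

IsTwinFreeCliqueNumber : ∀ {n} → Graph n → ℕ → Set
IsTwinFreeCliqueNumber {n} F k =
  (∃ λ (C : Subset n) → IsClique F C × TwinFree F C × ∣ C ∣ ≡ k)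
  × (∀ (C : Subset n) → IsClique F C → TwinFree F C → ∣ C ∣ ≤ k)

module _ {n : ℕ} (F : Graph n) where

  closedNbr-refl : ∀ a → closedNbr F a a ≡ true
  closedNbr-refl a = ∨-trueˡ (F a a) (isYes-true (a ≟ a) refl)

  closedNbr-edge : ∀ {a c} → F a c ≡ true → closedNbr F a c ≡ true
  closedNbr-edge {a} {c} = ∨-trueʳ (isYes (a ≟ c))

  closedNbr-cases : ∀ {a c} → closedNbr F a c ≡ true → a ≡ c ⊎ F a c ≡ true
  closedNbr-cases {a} {c} e with ∨-true⁻ {isYes (a ≟ c)} e
  ... | inj₁ a≡c = inj₁ (isYes-sound (a ≟ c) a≡c)
  ... | inj₂ fac = inj₂ fac

  twins-sym : ∀ {a a′} → TrueTwins F a a′ → TrueTwins F a′ a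
  twins-sym (a≢a′ , same) = a≢a′ ∘ sym , sym ∘ same

  twins-adjacent : ∀ {a a′} → TrueTwins F a a′ → F a a′ ≡ true
  twins-adjacent {a} {a′} (a≢a′ , same) with closedNbr-cases (trans (same a′) (closedNbr-refl a′))
  ... | inj₁ a≡a′ = contradiction a≡a′ a≢a′
  ... | inj₂ faa′ = faa′

-- The rooted product with a universal root

module RootedProduct {r s : ℕ} (G : Graph r) (H : Graph (suc s)) (v : Fin (suc s))
  (G-simple : IsSimple G) (H-simple : IsSimple H) (G-connected : Connected G)
  (v-universal : Universal H v) where

  X : Graph (r * suc s)
  X = rootedProduct G H v

  ⟨_,_⟩ : Fin r → Fin (suc s) → Fin (r * suc s)
  ⟨ i , b ⟩ = combine i b

  data Coordinates : Fin (r * suc s) → Set where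
    at : ∀ i b → Coordinates ⟨ i , b ⟩

  coordinates : ∀ p → Coordinates p
  coordinates p = subst Coordinates (combine-remQuot {r} (suc s) p) (at _ _)

  ⟨⟩-injective : ∀ {i b j y} → ⟨ i , b ⟩ ≡ ⟨ j , y ⟩ → i ≡ j × b ≡ y
  ⟨⟩-injective {i} {b} {j} {y} e = combine-injectiveˡ i b j y e , combine-injectiveʳ i b j y e

  X-adjacency : ∀ i b j y →
    X ⟨ i , b ⟩ ⟨ j , y ⟩ ≡ (isYes (i ≟ j) ∧ H b y) ∨ (isYes (b ≟ v) ∧ isYes (y ≟ v) ∧ G i j)
  X-adjacency i b j y = cong₂ adjacency (remQuot-combine i b) (remQuot-combine j y)
    where
      adjacency : Fin r × Fin (suc s) → Fin r × Fin (suc s) → Bool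
      adjacency (i , b) (j , y) = (isYes (i ≟ j) ∧ H b y) ∨ (isYes (b ≟ v) ∧ isYes (y ≟ v) ∧ G i j)

  X-sym : ∀ p q → X p q ≡ X q p
  X-sym p q with coordinates p | coordinates q
  ... | at i b | at j y = begin
    X ⟨ i , b ⟩ ⟨ j , y ⟩
      ≡⟨ X-adjacency i b j y ⟩
    (isYes (i ≟ j) ∧ H b y) ∨ (isYes (b ≟ v) ∧ isYes (y ≟ v) ∧ G i j)
      ≡⟨ cong₂ _∨_ (cong₂ _∧_ (isYes-≟-sym i j) (proj₁ H-simple b y))
                   (trans (x∧[y∧z]≡y∧[x∧z] (isYes (b ≟ v)) (isYes (y ≟ v)) (G i j))
                          (cong (λ g → isYes (y ≟ v) ∧ isYes (b ≟ v) ∧ g) (proj₁ G-simple i j))) ⟩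
    (isYes (j ≟ i) ∧ H y b) ∨ (isYes (y ≟ v) ∧ isYes (b ≟ v) ∧ G j i)
      ≡⟨ X-adjacency j y i b ⟨
    X ⟨ j , y ⟩ ⟨ i , b ⟩ ∎
    where open ≡-Reasoning

  edge-inside : ∀ {i b y} → H b y ≡ true → X ⟨ i , b ⟩ ⟨ i , y ⟩ ≡ true
  edge-inside {i} {b} {y} hby = trans (X-adjacency i b i y) (∨-trueˡ _ (cong₂ _∧_ (isYes-true (i ≟ i) refl) hby))

  edge-roots : ∀ {i j} → G i j ≡ true → X ⟨ i , v ⟩ ⟨ j , v ⟩ ≡ true
  edge-roots {i} {j} gij = trans (X-adjacency i v j v)
    (∨-trueʳ _ (cong₂ _∧_ (isYes-true (v ≟ v) refl) (cong₂ _∧_ (isYes-true (v ≟ v) refl) gij)))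

  root-adjacent : ∀ {b} → b ≢ v → H b v ≡ true
  root-adjacent {b} b≢v = trans (proj₁ H-simple b v) (v-universal b b≢v)

  edge-toRoot : ∀ {i b} → b ≢ v → X ⟨ i , b ⟩ ⟨ i , v ⟩ ≡ true
  edge-toRoot b≢v = edge-inside (root-adjacent b≢v)

  edge-fromRoot : ∀ {i b} → b ≢ v → X ⟨ i , v ⟩ ⟨ i , b ⟩ ≡ true
  edge-fromRoot {b = b} b≢v = edge-inside (v-universal b b≢v)

  edge-cases : ∀ {i b j y} → X ⟨ i , b ⟩ ⟨ j , y ⟩ ≡ true →
    (i ≡ j × H b y ≡ true) ⊎ (b ≡ v × y ≡ v × G i j ≡ true)
  edge-cases {i} {b} {j} {y} e with ∨-true⁻ {isYes (i ≟ j) ∧ H b y} (trans (sym (X-adjacency i b j y)) e)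
  ... | inj₁ inside with i≡j , hby ← ∧-true⁻ inside = inj₁ (isYes-sound (i ≟ j) i≡j , hby)
  ... | inj₂ roots with b≡v , rest ← ∧-true⁻ roots with y≡v , gij ← ∧-true⁻ rest =
    inj₂ (isYes-sound (b ≟ v) b≡v , isYes-sound (y ≟ v) y≡v , gij)

  toRoot : ∀ i b → ∃ λ k → Walk X k ⟨ i , b ⟩ ⟨ i , v ⟩
  toRoot i b with b ≟ v
  ... | yes refl = 0 , []
  ... | no  b≢v  = 1 , edge-toRoot b≢v ∷ []

  fromRoot : ∀ i b → ∃ λ k → Walk X k ⟨ i , v ⟩ ⟨ i , b ⟩
  fromRoot i b with b ≟ v
  ... | yes refl = 0 , []
  ... | no  b≢v  = 1 , edge-fromRoot b≢v ∷ []

  liftRoots : ∀ {k i j} → Walk G k i j → Walk X k ⟨ i , v ⟩ ⟨ j , v ⟩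
  liftRoots []        = []
  liftRoots (gij ∷ w) = edge-roots gij ∷ liftRoots w

  X-connected : Connected X
  X-connected p q with coordinates p | coordinates q
  ... | at i b | at j y
    with k , gij ← G-connected i j | k₁ , up ← toRoot i b | k₂ , down ← fromRoot j y =
    k₁ + (k + k₂) , Walk⇒reach X (up ++ᵂ (liftRoots (reach⇒Walk G k gij) ++ᵂ down))

  open Metric X X-sym X-connected public

  ⟨,⟩-≢ʳ : ∀ {i b y} → b ≢ y → ⟨ i , b ⟩ ≢ ⟨ i , y ⟩
  ⟨,⟩-≢ʳ b≢y = b≢y ∘ proj₂ ∘ ⟨⟩-injective

  OutsideCopy : Fin r → Fin (r * suc s) → Set
  OutsideCopy i u = ∀ b → u ≢ ⟨ i , b ⟩

  outsideCopy : ∀ {i j} y → i ≢ j → OutsideCopy i ⟨ j , y ⟩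
  outsideCopy y i≢j b e = i≢j (sym (proj₁ (⟨⟩-injective e)))

  exit-through-root : ∀ {k i b u} → b ≢ v → OutsideCopy i u → Walk X k ⟨ i , b ⟩ u →
    ∃ λ k′ → k′ < k × Walk X k′ ⟨ i , v ⟩ u
  exit-through-root b≢v out [] = contradiction refl (out _)
  exit-through-root b≢v out (_∷_ {y = z} e w) with coordinates z
  ... | at j y with edge-cases e
  ... | inj₂ (b≡v , _) = contradiction b≡v b≢v
  ... | inj₁ (refl , _) with y ≟ v
  ... | yes refl = _ , ≤-refl , w
  ... | no y≢v with k′ , k′<k , w′ ← exit-through-root y≢v out w = k′ , m<n⇒m<1+n k′<k , w′

  dist-via-root : ∀ {i b u} → b ≢ v → OutsideCopy i u → d ⟨ i , b ⟩ u ≡ suc (d ⟨ i , v ⟩ u)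
  dist-via-root {i} {b} {u} b≢v out with k , k<d , w ← exit-through-root b≢v out (shortest ⟨ i , b ⟩ u) =
    ≤-antisym (dist≤length X (edge-toRoot b≢v ∷ shortest ⟨ i , v ⟩ u)) (≤-trans (s≤s (dist≤length X w)) k<d)

  dist-via-rootʳ : ∀ {i b u} → b ≢ v → OutsideCopy i u → d u ⟨ i , b ⟩ ≡ suc (d u ⟨ i , v ⟩)
  dist-via-rootʳ {i} {b} {u} b≢v out = begin
    d u ⟨ i , b ⟩          ≡⟨ dist-sym u ⟨ i , b ⟩ ⟩
    d ⟨ i , b ⟩ u          ≡⟨ dist-via-root b≢v out ⟩
    suc (d ⟨ i , v ⟩ u)    ≡⟨ cong suc (dist-sym ⟨ i , v ⟩ u) ⟩
    suc (d u ⟨ i , v ⟩)    ∎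
    where open ≡-Reasoning

  dist-inside≤2 : ∀ {i b y} → b ≢ v → y ≢ v → d ⟨ i , b ⟩ ⟨ i , y ⟩ ≤ 2
  dist-inside≤2 {i} b≢v y≢v = dist≤length X (edge-toRoot {i} b≢v ∷ edge-fromRoot {i} y≢v ∷ [])

  dist-nonadjacent : ∀ {i b y} → b ≢ v → b ≢ y → H b y ≡ false → d ⟨ i , b ⟩ ⟨ i , y ⟩ ≡ 2
  dist-nonadjacent {i} {b} {y} b≢v b≢y hby = ≤-antisym (dist-inside≤2 b≢v y≢v) (2≤ (d ⟨ i , b ⟩ ⟨ i , y ⟩) refl)
    where
      y≢v : y ≢ v
      y≢v refl = contradiction (trans (sym hby) (root-adjacent b≢v)) λ ()
      2≤ : ∀ m → d ⟨ i , b ⟩ ⟨ i , y ⟩ ≡ m → 2 ≤ m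
      2≤ 0 d≡0 = contradiction (dist≡0⇒≡ X d≡0) (⟨,⟩-≢ʳ b≢y)
      2≤ 1 d≡1 with edge-cases (dist≡1⇒edge d≡1)
      ... | inj₁ (_ , hby′)  = contradiction (trans (sym hby) hby′) λ ()
      ... | inj₂ (b≡v , _)   = contradiction b≡v b≢v
      2≤ (suc (suc m)) _ = s≤s (s≤s z≤n)

  dist-adjacent : ∀ {i b y} → b ≢ y → H b y ≡ true → d ⟨ i , b ⟩ ⟨ i , y ⟩ ≡ 1
  dist-adjacent b≢y hby = dist-edge X (edge-inside hby) (⟨,⟩-≢ʳ b≢y)

  maximallyDistant-otherCopy : ∀ {i b j y} → i ≢ j → y ≢ v → MaximallyDistant X ⟨ j , y ⟩ ⟨ i , b ⟩
  maximallyDistant-otherCopy {i} {b} {j} {y} i≢j y≢v z e with coordinates z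
  ... | at j′ y′ with edge-cases e
  ... | inj₂ (y≡v , _) = contradiction y≡v y≢v
  ... | inj₁ (refl , _) = ≤-trans (near (y′ ≟ v)) (≤-reflexive (sym (dist-via-root y≢v out)))
    where
      out : OutsideCopy j ⟨ i , b ⟩
      out = outsideCopy b (i≢j ∘ sym)
      near : Dec (y′ ≡ v) → d ⟨ j , y′ ⟩ ⟨ i , b ⟩ ≤ suc (d ⟨ j , v ⟩ ⟨ i , b ⟩)
      near (yes refl) = n≤1+n _
      near (no y′≢v)  = ≤-reflexive (dist-via-root y′≢v out)

  maximallyDistant-nonadjacent : ∀ {i b y} → b ≢ v → y ≢ v → b ≢ y → H b y ≡ false →
    MaximallyDistant X ⟨ i , y ⟩ ⟨ i , b ⟩
  maximallyDistant-nonadjacent {i} {b} {y} b≢v y≢v b≢y hby z e with coordinates z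
  ... | at j y′ with edge-cases e
  ... | inj₂ (y≡v , _) = contradiction y≡v y≢v
  ... | inj₁ (refl , _) = ≤-trans near (≤-reflexive (sym far))
    where
      far : d ⟨ i , y ⟩ ⟨ i , b ⟩ ≡ 2
      far = dist-nonadjacent y≢v (b≢y ∘ sym) (trans (proj₁ H-simple y b) hby)
      near : d ⟨ i , y′ ⟩ ⟨ i , b ⟩ ≤ 2
      near with y′ ≟ v
      ... | yes refl = m≤n⇒m≤1+n (dist≤length X (edge-fromRoot {j} b≢v ∷ []))
      ... | no  y′≢v = dist-inside≤2 y′≢v b≢v

  maximallyDistant-dominated : ∀ {i b y} → y ≢ v → b ≢ y → H b y ≡ true →
    (∀ z → H y z ≡ true → b ≡ z ⊎ H b z ≡ true) → MaximallyDistant X ⟨ i , y ⟩ ⟨ i , b ⟩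
  maximallyDistant-dominated {i} {b} {y} y≢v b≢y hby N[y]⊆N[b] z e with coordinates z
  ... | at j y′ with edge-cases e
  ... | inj₂ (y≡v , _) = contradiction y≡v y≢v
  ... | inj₁ (refl , hyy′) = ≤-trans near (≤-reflexive (sym (dist-adjacent (b≢y ∘ sym) (trans (proj₁ H-simple y b) hby))))
    where
      near : d ⟨ i , y′ ⟩ ⟨ i , b ⟩ ≤ 1
      near with N[y]⊆N[b] y′ hyy′
      ... | inj₁ refl = ≤-trans (≤-reflexive (dist-refl X ⟨ i , b ⟩)) z≤n
      ... | inj₂ hby′ = dist≤length X (edge-inside {j} (trans (proj₁ H-simple y′ b) hby′) ∷ [])

  resolves-root-from-copy : ∀ {i b x} → b ≢ v → OutsideCopy i x → StronglyResolves X ⟨ i , b ⟩ ⟨ i , v ⟩ x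
  resolves-root-from-copy {i} {b} {x} b≢v out = inj₂ (begin
    d ⟨ i , b ⟩ x                          ≡⟨ dist-via-root b≢v out ⟩
    1 + d ⟨ i , v ⟩ x                      ≡⟨ cong (_+ d ⟨ i , v ⟩ x) (dist-adjacent b≢v (root-adjacent b≢v)) ⟨
    d ⟨ i , b ⟩ ⟨ i , v ⟩ + d ⟨ i , v ⟩ x  ∎)
    where open ≡-Reasoning

  resolves-copy-from-outside : ∀ {i b w} → b ≢ v → OutsideCopy i w → StronglyResolves X w ⟨ i , v ⟩ ⟨ i , b ⟩
  resolves-copy-from-outside {i} {b} {w} b≢v out = inj₂ (begin
    d w ⟨ i , b ⟩                          ≡⟨ dist-via-rootʳ b≢v out ⟩
    suc (d w ⟨ i , v ⟩)                    ≡⟨ +-comm 1 _ ⟩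
    d w ⟨ i , v ⟩ + 1                      ≡⟨ cong (d w ⟨ i , v ⟩ +_) (dist-adjacent (b≢v ∘ sym) (v-universal b b≢v)) ⟨
    d w ⟨ i , v ⟩ + d ⟨ i , v ⟩ ⟨ i , b ⟩  ∎)
    where open ≡-Reasoning

  resolves-inside : ∀ {i z b y} → z ≢ v → z ≢ b → z ≢ y → b ≢ y →
    H z b ≡ true → H z y ≡ false → H b y ≡ true → StronglyResolves X ⟨ i , z ⟩ ⟨ i , b ⟩ ⟨ i , y ⟩
  resolves-inside z≢v z≢b z≢y b≢y hzb hzy hby =
    inj₂ (trans (dist-nonadjacent z≢v z≢y hzy) (sym (cong₂ _+_ (dist-adjacent z≢b hzb) (dist-adjacent b≢y hby))))

  mutuallyMaximallyDistant-otherCopies : ∀ {i b j y} → i ≢ j → b ≢ v → y ≢ v →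
    MutuallyMaximallyDistant X ⟨ i , b ⟩ ⟨ j , y ⟩
  mutuallyMaximallyDistant-otherCopies i≢j b≢v y≢v =
    maximallyDistant-otherCopy i≢j y≢v , maximallyDistant-otherCopy (i≢j ∘ sym) b≢v

  mutuallyMaximallyDistant-nonadjacent : ∀ {i b y} → b ≢ v → y ≢ v → b ≢ y → H b y ≡ false →
    MutuallyMaximallyDistant X ⟨ i , b ⟩ ⟨ i , y ⟩
  mutuallyMaximallyDistant-nonadjacent {b = b} {y} b≢v y≢v b≢y hby =
    maximallyDistant-nonadjacent b≢v y≢v b≢y hby ,
    maximallyDistant-nonadjacent y≢v b≢v (b≢y ∘ sym) (trans (proj₁ H-simple y b) hby)

  F : Graph s
  F = deleteVertex H v

  ι : Fin s → Fin (suc s)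
  ι = punchIn v

  ι≢v : ∀ a → ι a ≢ v
  ι≢v = punchInᵢ≢i v

  ι-≢ : ∀ {a a′} → a ≢ a′ → ι a ≢ ι a′
  ι-≢ a≢a′ = a≢a′ ∘ punchIn-injective v _ _

  ι-onto : ∀ {z} → z ≢ v → ∃ λ c → ι c ≡ z
  ι-onto z≢v = punchOut (z≢v ∘ sym) , punchIn-punchOut (z≢v ∘ sym)

  twins-dominated : ∀ {a a′} → TrueTwins F a a′ → ∀ z → H (ι a′) z ≡ true → ι a ≡ z ⊎ H (ι a) z ≡ true
  twins-dominated {a} {a′} (_ , same) z ha′z with z ≟ v
  ... | yes refl = inj₂ (root-adjacent (ι≢v a))
  ... | no  z≢v with c , refl ← ι-onto z≢v
    with closedNbr-cases F (trans (same c) (closedNbr-edge F ha′z))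
  ... | inj₁ refl = inj₁ refl
  ... | inj₂ fac  = inj₂ fac

  mutuallyMaximallyDistant-twins : ∀ {i a a′} → TrueTwins F a a′ → MutuallyMaximallyDistant X ⟨ i , ι a ⟩ ⟨ i , ι a′ ⟩
  mutuallyMaximallyDistant-twins {a = a} {a′} twins@(a≢a′ , _) =
    maximallyDistant-dominated (ι≢v a′) (ι-≢ a≢a′) (twins-adjacent F twins) (twins-dominated twins) ,
    maximallyDistant-dominated (ι≢v a) (ι-≢ (a≢a′ ∘ sym)) (twins-adjacent F (twins-sym F twins)) (twins-dominated (twins-sym F twins))

  module LowerBound {S : Subset (r * suc s)} (gen : IsStrongMetricGenerator X S) where

    Missing : Fin r → Subset s
    Missing i = tabulate (λ a → not (lookup S ⟨ i , ι a ⟩))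

    missing-∉ : ∀ {i a} → a ∈ Missing i → ⟨ i , ι a ⟩ ∉ S
    missing-∉ {i} {a} a∈ ∈S with trans (sym (∈tabulate⁻ a∈)) (cong not (∈⇒lookup ∈S))
    ... | ()

    not-both-missing : ∀ {i a j a′} → ⟨ i , ι a ⟩ ≢ ⟨ j , ι a′ ⟩ →
      MutuallyMaximallyDistant X ⟨ i , ι a ⟩ ⟨ j , ι a′ ⟩ → a ∈ Missing i → a′ ∈ Missing j → ⊥
    not-both-missing distinct mmd a∈ a′∈ =
      [ missing-∉ a∈ , missing-∉ a′∈ ]′ (generator-meets-mutuallyMaximallyDistant gen distinct mmd)

    missing-clique : ∀ i → IsClique F (Missing i)
    missing-clique i a a′ a∈ a′∈ a≢a′ with F a a′ in faa′
    ... | true  = refl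
    ... | false = ⊥-elim (not-both-missing (⟨,⟩-≢ʳ (ι-≢ a≢a′))
      (mutuallyMaximallyDistant-nonadjacent (ι≢v a) (ι≢v a′) (ι-≢ a≢a′) faa′) a∈ a′∈)

    missing-twinFree : ∀ i → TwinFree F (Missing i)
    missing-twinFree i a a′ a∈ a′∈ twins =
      not-both-missing (⟨,⟩-≢ʳ (ι-≢ (proj₁ twins))) (mutuallyMaximallyDistant-twins twins) a∈ a′∈

    missing-in-one-copy : ∀ i j → i ≢ j → ∣ Missing i ∣ ≡ 0 ⊎ ∣ Missing j ∣ ≡ 0
    missing-in-one-copy i j i≢j with nonempty? (Missing i) | nonempty? (Missing j)
    ... | no ¬∃a | _      = inj₁ (empty⇒∣∣≡0 ¬∃a)
    ... | yes _  | no ¬∃a = inj₂ (empty⇒∣∣≡0 ¬∃a)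
    ... | yes (a , a∈) | yes (a′ , a′∈) = ⊥-elim (not-both-missing (i≢j ∘ proj₁ ∘ ⟨⟩-injective)
      (mutuallyMaximallyDistant-otherCopies i≢j (ι≢v a) (ι≢v a′)) a∈ a′∈)

    present : Fin r → ℕ
    present i = countFin (λ a → lookup S ⟨ i , ι a ⟩)

    present+missing : ∀ i → present i + ∣ Missing i ∣ ≡ s
    present+missing i = trans (cong (present i +_) (∣tabulate∣≡countFin (λ a → not (lookup S ⟨ i , ι a ⟩))))
                              (countFin-not (λ a → lookup S ⟨ i , ι a ⟩))

    ∑present≤∣S∣ : sum present ≤ ∣ S ∣
    ∑present≤∣S∣ = begin
      sum present                                          ≤⟨ ∑-mono-≤ present≤ ⟩
      sum (λ i → countFin (λ b → lookup S ⟨ i , b ⟩))     ≡⟨ countFin-combine r (suc s) (lookup S) ⟨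
      countFin (lookup S)                                  ≡⟨ ∣S∣≡countFin S ⟨
      ∣ S ∣                                                ∎
      where
        open ≤-Reasoning
        present≤ : ∀ i → present i ≤ countFin (λ b → lookup S ⟨ i , b ⟩)
        present≤ i = ≤-trans (m≤n+m _ _) (≤-reflexive (sym (countFin-punchIn (λ b → lookup S ⟨ i , b ⟩) v)))

    generator-size : ∀ {τ} → (∀ C → IsClique F C → TwinFree F C → ∣ C ∣ ≤ τ) → r * s ≤ ∣ S ∣ + τ
    generator-size {τ} τ-max = begin
      r * s                                          ≡⟨ ∑-const r s ⟨
      sum {r} (λ _ → s)                              ≡⟨ sum-cong-≗ present+missing ⟨
      sum (λ i → present i + ∣ Missing i ∣)          ≡⟨ ∑-distrib-+ present (λ i → ∣ Missing i ∣) ⟩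
      sum present + sum (λ i → ∣ Missing i ∣)        ≤⟨ +-mono-≤ ∑present≤∣S∣ (∑-≤-sparse (λ i → ∣ Missing i ∣)
                                                          (λ i → τ-max (Missing i) (missing-clique i) (missing-twinFree i)) missing-in-one-copy) ⟩
      ∣ S ∣ + τ                                      ∎
      where open ≤-Reasoning

  module UpperBound (i₀ j₀ : Fin r) (i₀≢j₀ : i₀ ≢ j₀) (a₀ : Fin s)
                    {K : Subset s} (K-clique : IsClique F K) (K-twinFree : TwinFree F K) where

    chosen : Fin r → Fin s → Bool
    chosen i a = isYes (i ≟ i₀) ∧ lookup K a

    omitted : Fin r → Fin (suc s) → Bool
    omitted i b = isYes (b ≟ v) ∨ (isYes (i ≟ i₀) ∧ image ι (lookup K) b)

    omitted-root : ∀ i → omitted i v ≡ true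
    omitted-root i = ∨-trueˡ _ (isYes-true (v ≟ v) refl)

    omitted-ι : ∀ i a → omitted i (ι a) ≡ chosen i a
    omitted-ι i a = cong₂ _∨_ (isYes-false (ι a ≟ v) (ι≢v a))
                              (cong (isYes (i ≟ i₀) ∧_) (image-at (lookup K) (punchIn-injective v _ _) a))

    omitted-cases : ∀ {i b} → omitted i b ≡ true → b ≡ v ⊎ (i ≡ i₀ × ∃ λ a → ι a ≡ b × a ∈ K)
    omitted-cases {i} {b} e with ∨-true⁻ {isYes (b ≟ v)} e
    ... | inj₁ b≡v = inj₁ (isYes-sound (b ≟ v) b≡v)
    ... | inj₂ chosen-b with i≡i₀ , img ← ∧-true⁻ chosen-b with a , a∈K , ιa≡b ← image-sound ι (lookup K) img =
      inj₂ (isYes-sound (i ≟ i₀) i≡i₀ , a , ιa≡b , lookup⇒∈ a∈K)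

    W : Subset (r * suc s)
    W = tabulate (λ p → not (uncurry omitted (remQuot {r} (suc s) p)))

    lookup-W : ∀ i b → lookup W ⟨ i , b ⟩ ≡ not (omitted i b)
    lookup-W i b = trans (lookup∘tabulate _ ⟨ i , b ⟩) (cong (λ ib → not (uncurry omitted ib)) (remQuot-combine i b))

    kept : ∀ {i b} → omitted i b ≡ false → ⟨ i , b ⟩ ∈ W
    kept {i} {b} e = lookup⇒∈ (trans (lookup-W i b) (cong not e))

    kept-otherCopy : ∀ {i} → i ≢ i₀ → ∀ a → ⟨ i , ι a ⟩ ∈ W
    kept-otherCopy {i} i≢i₀ a = kept (trans (omitted-ι i a) (cong (_∧ lookup K a) (isYes-false (i ≟ i₀) i≢i₀)))

    kept-unchosen : ∀ i {a} → lookup K a ≡ false → ⟨ i , ι a ⟩ ∈ W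
    kept-unchosen i {a} a∉K = kept (trans (omitted-ι i a) (trans (cong (isYes (i ≟ i₀) ∧_) a∉K) (∧-zeroʳ _)))

    Resolved : Fin (r * suc s) → Fin (r * suc s) → Set
    Resolved u x = ∃ λ w → w ∈ W × StronglyResolves X w u x

    resolved-sym : ∀ {u x} → Resolved u x → Resolved x u
    resolved-sym (w , w∈W , w-res) = w , w∈W , resolves-sym X w-res

    resolved-roots : ∀ i j → i ≢ j → Resolved ⟨ i , v ⟩ ⟨ j , v ⟩
    resolved-roots i j i≢j with i ≟ i₀
    ... | no  i≢i₀ = ⟨ i , ι a₀ ⟩ , kept-otherCopy i≢i₀ a₀ , resolves-root-from-copy (ι≢v a₀) (outsideCopy v i≢j)
    ... | yes refl = resolved-sym
      (⟨ j , ι a₀ ⟩ , kept-otherCopy (i≢j ∘ sym) a₀ , resolves-root-from-copy (ι≢v a₀) (outsideCopy v (i≢j ∘ sym)))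

    resolved-root-chosen : ∀ i a → Resolved ⟨ i , v ⟩ ⟨ i₀ , ι a ⟩
    resolved-root-chosen i a with i ≟ i₀
    ... | yes refl = ⟨ j₀ , ι a₀ ⟩ , kept-otherCopy (i₀≢j₀ ∘ sym) a₀ ,
                     resolves-copy-from-outside (ι≢v a) (outsideCopy (ι a₀) i₀≢j₀)
    ... | no  i≢i₀ = ⟨ i , ι a₀ ⟩ , kept-otherCopy i≢i₀ a₀ , resolves-root-from-copy (ι≢v a₀) (outsideCopy (ι a) i≢i₀)

    -- A private neighbour z ∈ N[a] ∖ N[a′] of a cannot lie in the clique K, so its copy is kept.
    resolved-by-private-neighbour : ∀ {a a′ z} → a ∈ K → a′ ∈ K → a ≢ a′ →
      closedNbr F a z ≡ true → closedNbr F a′ z ≡ false → Resolved ⟨ i₀ , ι a ⟩ ⟨ i₀ , ι a′ ⟩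
    resolved-by-private-neighbour {a} {a′} {z} a∈K a′∈K a≢a′ a~z a′≁z =
      ⟨ i₀ , ι z ⟩ , kept-unchosen i₀ z∉K ,
      resolves-inside (ι≢v z) (ι-≢ z≢a) (ι-≢ z≢a′) (ι-≢ a≢a′)
        (trans (proj₁ H-simple (ι z) (ι a)) faz) (trans (proj₁ H-simple (ι z) (ι a′)) fa′z) (K-clique a a′ a∈K a′∈K a≢a′)
      where
        z≢a′ : z ≢ a′
        z≢a′ refl = contradiction (trans (sym a′≁z) (closedNbr-refl F z)) λ ()
        fa′z : F a′ z ≡ false
        fa′z = ¬-not λ fa′z → contradiction (trans (sym a′≁z) (closedNbr-edge F fa′z)) λ ()
        z∉K : lookup K z ≡ false
        z∉K = ¬-not λ z∈K → contradiction (trans (sym fa′z) (K-clique a′ z a′∈K (lookup⇒∈ z∈K) (z≢a′ ∘ sym))) λ ()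
        z≢a : z ≢ a
        z≢a refl = contradiction (trans (sym z∉K) (∈⇒lookup a∈K)) λ ()
        faz : F a z ≡ true
        faz with closedNbr-cases F a~z
        ... | inj₁ a≡z = contradiction (sym a≡z) z≢a
        ... | inj₂ faz = faz

    resolved-chosen : ∀ {a a′} → a ∈ K → a′ ∈ K → a ≢ a′ → Resolved ⟨ i₀ , ι a ⟩ ⟨ i₀ , ι a′ ⟩
    resolved-chosen {a} {a′} a∈K a′∈K a≢a′
      with z , differ ← ¬∀⟶∃¬ s _ (λ z → closedNbr F a z Bool.≟ closedNbr F a′ z)
                                   (λ same → K-twinFree a a′ a∈K a′∈K (a≢a′ , same))
      with closedNbr F a z in a~z | closedNbr F a′ z in a′~z
    ... | true  | false = resolved-by-private-neighbour a∈K a′∈K a≢a′ a~z a′~z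
    ... | false | true  = resolved-sym (resolved-by-private-neighbour a′∈K a∈K (a≢a′ ∘ sym) a′~z a~z)
    ... | true  | true  = contradiction refl differ
    ... | false | false = contradiction refl differ

    W-generator : IsStrongMetricGenerator X W
    W-generator p q p≢q with coordinates p | coordinates q
    ... | at i b | at j y with omitted i b in oib | omitted j y in ojy
    ... | false | _     = ⟨ i , b ⟩ , kept {i} {b} oib , resolves-selfˡ X _ _
    ... | true  | false = ⟨ j , y ⟩ , kept {j} {y} ojy , resolves-selfʳ X _ _
    ... | true  | true with omitted-cases {i} {b} oib | omitted-cases {j} {y} ojy
    ... | inj₁ refl | inj₁ refl = resolved-roots i j (p≢q ∘ cong (λ k → ⟨ k , v ⟩))
    ... | inj₁ refl | inj₂ (refl , a , refl , _) = resolved-root-chosen i a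
    ... | inj₂ (refl , a , refl , _) | inj₁ refl = resolved-sym (resolved-root-chosen j a)
    ... | inj₂ (refl , a , refl , a∈K) | inj₂ (refl , a′ , refl , a′∈K) =
      resolved-chosen a∈K a′∈K (p≢q ∘ cong (λ c → ⟨ i₀ , ι c ⟩))

    ∑chosen≡∣K∣ : sum (λ i → countFin (chosen i)) ≡ ∣ K ∣
    ∑chosen≡∣K∣ = begin
      sum (λ i → countFin (chosen i))   ≡⟨ ∑-concentrated _ i₀ (λ i i≢i₀ → countFin-false _ (unchosen i≢i₀)) ⟩
      countFin (chosen i₀)              ≡⟨ countFin-cong (λ a → cong (_∧ lookup K a) (isYes-true (i₀ ≟ i₀) refl)) ⟩
      countFin (lookup K)               ≡⟨ ∣S∣≡countFin K ⟨
      ∣ K ∣                             ∎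
      where
        open ≡-Reasoning
        unchosen : ∀ {i} → i ≢ i₀ → ∀ a → chosen i a ≡ false
        unchosen {i} i≢i₀ a = cong (_∧ lookup K a) (isYes-false (i ≟ i₀) i≢i₀)

    kept-in-copy : ∀ i → countFin (λ b → lookup W ⟨ i , b ⟩) ≡ countFin (λ a → not (chosen i a))
    kept-in-copy i = begin
      countFin (λ b → lookup W ⟨ i , b ⟩)                              ≡⟨ countFin-cong (lookup-W i) ⟩
      countFin (λ b → not (omitted i b))                               ≡⟨ countFin-punchIn (λ b → not (omitted i b)) v ⟩
      𝟙 (not (omitted i v)) + countFin (λ a → not (omitted i (ι a)))  ≡⟨ cong₂ _+_ (cong (𝟙 ∘ not) (omitted-root i)) (countFin-cong (cong not ∘ omitted-ι i)) ⟩
      countFin (λ a → not (chosen i a))                                ∎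
      where open ≡-Reasoning

    W-size : ∣ W ∣ + ∣ K ∣ ≡ r * s
    W-size = begin
      ∣ W ∣ + ∣ K ∣
        ≡⟨ cong₂ _+_ (trans (∣S∣≡countFin W) (countFin-combine r (suc s) (lookup W))) (sym ∑chosen≡∣K∣) ⟩
      sum (λ i → countFin (λ b → lookup W ⟨ i , b ⟩)) + sum (λ i → countFin (chosen i))
        ≡⟨ cong (_+ sum (λ i → countFin (chosen i))) (sum-cong-≗ kept-in-copy) ⟩
      sum (λ i → countFin (λ a → not (chosen i a))) + sum (λ i → countFin (chosen i))
        ≡⟨ ∑-distrib-+ (λ i → countFin (λ a → not (chosen i a))) (λ i → countFin (chosen i)) ⟨
      sum (λ i → countFin (λ a → not (chosen i a)) + countFin (chosen i))
        ≡⟨ sum-cong-≗ (λ i → trans (+-comm (countFin (λ a → not (chosen i a))) _) (countFin-not (chosen i))) ⟩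
      sum {r} (λ _ → s)
        ≡⟨ ∑-const r s ⟩
      r * s ∎
      where open ≡-Reasoning

  strongMetricDim : ∀ (i₀ j₀ : Fin r) → i₀ ≢ j₀ → Fin s → ∀ {τ} → IsTwinFreeCliqueNumber F τ →
    IsStrongMetricDim X (r * s ∸ τ)
  strongMetricDim i₀ j₀ i₀≢j₀ a₀ {τ} ((K , K-clique , K-twinFree , ∣K∣≡τ) , τ-max) =
    (W , W-generator , ∣W∣≡) , minimal
    where
      open UpperBound i₀ j₀ i₀≢j₀ a₀ K-clique K-twinFree
      ∣W∣≡ : ∣ W ∣ ≡ r * s ∸ τ
      ∣W∣≡ = begin
        ∣ W ∣              ≡⟨ m+n∸n≡m ∣ W ∣ τ ⟨
        ∣ W ∣ + τ ∸ τ      ≡⟨ cong (λ k → ∣ W ∣ + k ∸ τ) ∣K∣≡τ ⟨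
        ∣ W ∣ + ∣ K ∣ ∸ τ  ≡⟨ cong (_∸ τ) W-size ⟩
        r * s ∸ τ          ∎
        where open ≡-Reasoning
      minimal : ∀ S → IsStrongMetricGenerator X S → r * s ∸ τ ≤ ∣ S ∣
      minimal S gen = m≤n+o⇒m∸n≤o (r * s) τ (subst (r * s ≤_) (+-comm ∣ S ∣ τ) (LowerBound.generator-size gen τ-max))

-- Vertices of full degree

degree≡n⇒universal : ∀ {n} (A : Graph (suc n)) → IsSimple A → ∀ a → degree A a ≡ n → Universal A a
degree≡n⇒universal {n} A (_ , loopless) a deg b b≢a
  with closedNbr-cases A (countFin≡n⇒true (closedNbr A a) ∣N[a]∣≡ b)
  where
    disjoint : ∀ b → (isYes (a ≟ b) ∧ A a b) ≡ false
    disjoint b with a ≟ b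
    ... | yes refl = loopless a
    ... | no  _    = refl
    ∣N[a]∣≡ : countFin (closedNbr A a) ≡ suc n
    ∣N[a]∣≡ = begin
      countFin (closedNbr A a)                             ≡⟨ countFin-disjoint-∨ (λ b → isYes (a ≟ b)) (A a) disjoint ⟩
      countFin (λ b → isYes (a ≟ b)) + countFin (A a)      ≡⟨ cong₂ _+_ (countFin-≟ a) deg ⟩
      suc n                                                ∎
      where open ≡-Reasoning
... | inj₁ a≡b = contradiction (sym a≡b) b≢a
... | inj₂ ab  = ab

CliqueOn : ∀ {n} → Graph n → (Fin n → Bool) → Set
CliqueOn F p = ∀ a a′ → p a ≡ true → p a′ ≡ true → a ≢ a′ → F a a′ ≡ true

module _ {n : ℕ} {F : Graph n} where

  clique⇒cliqueOn : ∀ {C} → IsClique F C → CliqueOn F (lookup C)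
  clique⇒cliqueOn C-clique a a′ ca ca′ = C-clique a a′ (lookup⇒∈ ca) (lookup⇒∈ ca′)

  cliqueOn⇒clique : ∀ {p} → CliqueOn F p → IsClique F (tabulate p)
  cliqueOn⇒clique p-clique a a′ a∈ a′∈ = p-clique a a′ (∈tabulate⁻ a∈) (∈tabulate⁻ a′∈)

twinFreeCliqueNumber-twinless : ∀ {n} {F : Graph n} {ω} → (∀ x y → ¬ TrueTwins F x y) →
  IsCliqueNumber F ω → IsTwinFreeCliqueNumber F ω
twinFreeCliqueNumber-twinless twinless ((K , K-clique , ∣K∣≡ω) , ω-max) =
  (K , K-clique , (λ a a′ _ _ → twinless a a′) , ∣K∣≡ω) , (λ C C-clique _ → ω-max C C-clique)

module UniversalTwins {n : ℕ} (F : Graph (suc n)) (F-simple : IsSimple F) {ω : ℕ} (ω-clique : IsCliqueNumber F ω)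
  (twins-universal : ∀ x y → TrueTwins F x y → degree F x ≡ n × degree F y ≡ n) where

  universal? : Fin (suc n) → Bool
  universal? a = isYes (degree F a ℕ.≟ n)

  universal : ∀ {a} → universal? a ≡ true → Universal F a
  universal {a} ua = degree≡n⇒universal F F-simple a (isYes-sound (degree F a ℕ.≟ n) ua)

  closedNbr-universal : ∀ {a} → universal? a ≡ true → ∀ z → closedNbr F a z ≡ true
  closedNbr-universal {a} ua z = by-cases (a ≟ z)
    where
      by-cases : Dec (a ≡ z) → closedNbr F a z ≡ true
      by-cases (yes refl) = closedNbr-refl F a
      by-cases (no a≢z)   = closedNbr-edge F (universal ua z (a≢z ∘ sym))

  universal-twins : ∀ {a a′} → universal? a ≡ true → universal? a′ ≡ true → a ≢ a′ → TrueTwins F a a′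
  universal-twins ua ua′ a≢a′ = a≢a′ , λ z → trans (closedNbr-universal ua z) (sym (closedNbr-universal ua′ z))

  clique-∪-universal : ∀ {p q} → CliqueOn F p → (∀ b → q b ≡ true → p b ≡ true ⊎ universal? b ≡ true) → CliqueOn F q
  clique-∪-universal p-clique q⊆ a a′ qa qa′ a≢a′ with q⊆ a qa | q⊆ a′ qa′
  ... | inj₁ pa | inj₁ pa′ = p-clique a a′ pa pa′ a≢a′
  ... | inj₂ ua | _        = universal ua a′ (a≢a′ ∘ sym)
  ... | inj₁ _  | inj₂ ua′ = trans (proj₁ F-simple a a′) (universal ua′ a a≢a′)

  cliqueOn-size : ∀ {p} → CliqueOn F p → countFin p ≤ ω
  cliqueOn-size {p} p-clique = subst (_≤ ω) (∣tabulate∣≡countFin p) (proj₂ ω-clique _ (cliqueOn⇒clique p-clique))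

  numUniversal≤ω : numWithDegree F n ≤ ω
  numUniversal≤ω = cliqueOn-size (clique-∪-universal {p = λ _ → false} (λ _ _ ()) (λ _ → inj₂))

  universal∈maximum : ∀ {K} → IsClique F K → ∣ K ∣ ≡ ω → ∀ {a} → universal? a ≡ true → lookup K a ≡ true
  universal∈maximum {K} K-clique ∣K∣≡ω {a} ua = ¬-not λ a∉K → <-irrefl refl (begin-strict
    ω                                            <⟨ m<m+n ω z<s ⟩
    ω + 1                                        ≡⟨ cong (_+ 1) ∣K∣≡ω ⟨
    ∣ K ∣ + 1                                    ≡⟨ cong₂ _+_ (∣S∣≡countFin K) (sym (countFin-≟ a)) ⟩
    countFin (lookup K) + countFin (λ b → isYes (a ≟ b))
                                                 ≡⟨ countFin-disjoint-∨ (lookup K) _ (disjoint a∉K) ⟨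
    countFin (λ b → lookup K b ∨ isYes (a ≟ b))  ≤⟨ cliqueOn-size (clique-∪-universal (clique⇒cliqueOn K-clique) K∪a⊆) ⟩
    ω                                            ∎)
    where
      open ≤-Reasoning
      disjoint : lookup K a ≡ false → ∀ b → (lookup K b ∧ isYes (a ≟ b)) ≡ false
      disjoint a∉K b with a ≟ b
      ... | yes refl = cong (_∧ true) a∉K
      ... | no  _    = ∧-zeroʳ _
      K∪a⊆ : ∀ b → (lookup K b ∨ isYes (a ≟ b)) ≡ true → lookup K b ≡ true ⊎ universal? b ≡ true
      K∪a⊆ b e with ∨-true⁻ {lookup K b} e
      ... | inj₁ b∈K = inj₁ b∈K
      ... | inj₂ a≡b with refl ← isYes-sound (a ≟ b) a≡b = inj₂ ua

  twinFree-bound : ∀ C → IsClique F C → TwinFree F C → ∣ C ∣ + numWithDegree F n ≤ suc ω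
  twinFree-bound C C-clique C-twinFree = begin
    ∣ C ∣ + numWithDegree F n                                     ≡⟨ cong (_+ numWithDegree F n) (∣S∣≡countFin C) ⟩
    countFin (lookup C) + countFin universal?                     ≡⟨ countFin-∨-∧ (lookup C) universal? ⟨
    countFin (λ b → lookup C b ∨ universal? b) + countFin (λ b → lookup C b ∧ universal? b)
      ≤⟨ +-mono-≤ (cliqueOn-size (clique-∪-universal (clique⇒cliqueOn C-clique) (λ _ → ∨-true⁻)))
                  (countFin≤1 _ at-most-one) ⟩
    ω + 1                                                         ≡⟨ +-comm ω 1 ⟩
    suc ω                                                         ∎
    where
      open ≤-Reasoning
      at-most-one : ∀ a a′ → (lookup C a ∧ universal? a) ≡ true → (lookup C a′ ∧ universal? a′) ≡ true → a ≡ a′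
      at-most-one a a′ ea ea′ with a ≟ a′
      ... | yes a≡a′ = a≡a′
      ... | no  a≢a′ with a∈C , ua ← ∧-true⁻ ea | a′∈C , ua′ ← ∧-true⁻ ea′ =
        contradiction (universal-twins ua ua′ a≢a′) (C-twinFree a a′ (lookup⇒∈ a∈C) (lookup⇒∈ a′∈C))

  twinFree-witness : ∀ {x} → universal? x ≡ true →
    ∃ λ C → IsClique F C × TwinFree F C × ∣ C ∣ + numWithDegree F n ≡ suc ω
  twinFree-witness {x} ux = tabulate K′ , K′-clique , K′-twinFree , K′-size
    where
      K : Subset (suc n)
      K = proj₁ (proj₁ ω-clique)
      K-clique : IsClique F K
      K-clique = proj₁ (proj₂ (proj₁ ω-clique))
      ∣K∣≡ω : ∣ K ∣ ≡ ω
      ∣K∣≡ω = proj₂ (proj₂ (proj₁ ω-clique))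

      nonuniversal : Fin (suc n) → Bool
      nonuniversal b = lookup K b ∧ not (universal? b)

      K′ : Fin (suc n) → Bool
      K′ b = nonuniversal b ∨ isYes (x ≟ b)

      K′-clique : IsClique F (tabulate K′)
      K′-clique = cliqueOn⇒clique (clique-∪-universal (clique⇒cliqueOn K-clique) K′⊆)
        where
          K′⊆ : ∀ b → K′ b ≡ true → lookup K b ≡ true ⊎ universal? b ≡ true
          K′⊆ b e with ∨-true⁻ {nonuniversal b} e
          ... | inj₁ nb  = inj₁ (proj₁ (∧-true⁻ nb))
          ... | inj₂ x≡b with refl ← isYes-sound (x ≟ b) x≡b = inj₂ ux

      K′-universal⇒x : ∀ {b} → K′ b ≡ true → universal? b ≡ true → x ≡ b
      K′-universal⇒x {b} e ub with ∨-true⁻ {nonuniversal b} e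
      ... | inj₁ nb  = contradiction (trans (sym (cong not ub)) (proj₂ (∧-true⁻ nb))) λ ()
      ... | inj₂ x≡b = isYes-sound (x ≟ b) x≡b

      K′-twinFree : TwinFree F (tabulate K′)
      K′-twinFree a a′ a∈ a′∈ twins@(a≢a′ , _) with deg-a , deg-a′ ← twins-universal a a′ twins =
        a≢a′ (trans (sym (K′-universal⇒x {a} (∈tabulate⁻ {p = K′} a∈) (isYes-true (degree F a ℕ.≟ n) deg-a)))
                    (K′-universal⇒x {a′} (∈tabulate⁻ {p = K′} a′∈) (isYes-true (degree F a′ ℕ.≟ n) deg-a′)))

      universal⊆K : ∀ b → (lookup K b ∧ universal? b) ≡ universal? b
      universal⊆K b with universal? b in ub
      ... | true  = trans (∧-identityʳ _) (universal∈maximum K-clique ∣K∣≡ω ub)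
      ... | false = ∧-zeroʳ _

      x-universal-only : ∀ b → (nonuniversal b ∧ isYes (x ≟ b)) ≡ false
      x-universal-only b with x ≟ b
      ... | yes refl = trans (∧-identityʳ _) (trans (cong (λ u → lookup K x ∧ not u) ux) (∧-zeroʳ _))
      ... | no  _    = ∧-zeroʳ _

      K′-size : ∣ tabulate K′ ∣ + numWithDegree F n ≡ suc ω
      K′-size = begin
        ∣ tabulate K′ ∣ + countFin universal?
          ≡⟨ cong (_+ countFin universal?) (trans (∣tabulate∣≡countFin K′) (countFin-disjoint-∨ nonuniversal _ x-universal-only)) ⟩
        (countFin nonuniversal + countFin (λ b → isYes (x ≟ b))) + countFin universal?
          ≡⟨ cong (λ k → (countFin nonuniversal + k) + countFin universal?) (countFin-≟ x) ⟩
        (countFin nonuniversal + 1) + countFin universal?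
          ≡⟨ [x+y]+z≡[x+z]+y (countFin nonuniversal) 1 (countFin universal?) ⟩
        (countFin nonuniversal + countFin universal?) + 1
          ≡⟨ cong (λ k → (countFin nonuniversal + k) + 1) (countFin-cong universal⊆K) ⟨
        (countFin nonuniversal + countFin (λ b → lookup K b ∧ universal? b)) + 1
          ≡⟨ cong (_+ 1) (+-comm (countFin nonuniversal) _) ⟩
        (countFin (λ b → lookup K b ∧ universal? b) + countFin nonuniversal) + 1
          ≡⟨ cong (_+ 1) (countFin-split (lookup K) universal?) ⟨
        countFin (lookup K) + 1
          ≡⟨ cong (_+ 1) (trans (sym (∣S∣≡countFin K)) ∣K∣≡ω) ⟩
        ω + 1
          ≡⟨ +-comm ω 1 ⟩
        suc ω ∎
        where open ≡-Reasoning

  twinFreeCliqueNumber : (∃ λ x → ∃ λ y → TrueTwins F x y) → IsTwinFreeCliqueNumber F (suc ω ∸ numWithDegree F n)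
  twinFreeCliqueNumber (x , y , twins)
    with C , C-clique , C-twinFree , ∣C∣+c≡ ← twinFree-witness (isYes-true (degree F x ℕ.≟ n) (proj₁ (twins-universal x y twins))) =
    (C , C-clique , C-twinFree , trans (sym (m+n∸n≡m ∣ C ∣ (numWithDegree F n))) (cong (_∸ numWithDegree F n) ∣C∣+c≡)) ,
    (λ C′ C′-clique C′-twinFree → m+n≤o⇒m≤o∸n ∣ C′ ∣ (twinFree-bound C′ C′-clique C′-twinFree))

deleteVertex-simple : ∀ {n} {H : Graph (suc n)} → IsSimple H → ∀ v → IsSimple (deleteVertex H v)
deleteVertex-simple (H-sym , H-loopless) v = (λ a b → H-sym (punchIn v a) (punchIn v b)) , (λ a → H-loopless (punchIn v a))

m+c∸1∸ω≡m∸[1+ω∸c] : ∀ m c ω → c ≤ suc ω → m + c ∸ 1 ∸ ω ≡ m ∸ (suc ω ∸ c)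
m+c∸1∸ω≡m∸[1+ω∸c] m c ω c≤1+ω = begin
  m + c ∸ 1 ∸ ω                   ≡⟨ ∸-+-assoc (m + c) 1 ω ⟩
  m + c ∸ suc ω                   ≡⟨ cong₂ _∸_ (+-comm m c) (sym (m+[n∸m]≡n c≤1+ω)) ⟩
  c + m ∸ (c + (suc ω ∸ c))       ≡⟨ [m+n]∸[m+o]≡n∸o c m (suc ω ∸ c) ⟩
  m ∸ (suc ω ∸ c)                 ∎
  where open ≡-Reasoning

corollary19 :
    (r s : ℕ) → 2 ≤ r → 1 ≤ s →
    (G : Graph r) → IsSimple G → Connected G →
    (H : Graph (suc s)) → IsSimple H → Connected H →
    (v : Fin (suc s)) → degree H v ≡ suc s ∸ 1 →
    (ω : ℕ) → IsCliqueNumber (deleteVertex H v) ω →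
    ((∀ x y → TrueTwins (deleteVertex H v) x y → ⊥) →
        IsStrongMetricDim (rootedProduct G H v) (r * (suc s ∸ 1) ∸ ω))
    ×
    ((∃ λ x → ∃ λ y → TrueTwins (deleteVertex H v) x y) →
     (∀ x y → TrueTwins (deleteVertex H v) x y →
        (degree (deleteVertex H v) x ≡ suc s ∸ 2) × (degree (deleteVertex H v) y ≡ suc s ∸ 2)) →
        IsStrongMetricDim (rootedProduct G H v)
          (r * (suc s ∸ 1) + numWithDegree (deleteVertex H v) (suc s ∸ 2) ∸ 1 ∸ ω))
corollary19 (suc (suc r)) (suc s) (s≤s (s≤s z≤n)) (s≤s z≤n) G G-simple G-connected H H-simple _ v deg ω ω-clique =
  (λ twinless → dim (twinFreeCliqueNumber-twinless twinless ω-clique)) ,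
  (λ twins twins-universal →
    let open UniversalTwins F (deleteVertex-simple H-simple v) ω-clique twins-universal in
    subst (IsStrongMetricDim X) (sym (m+c∸1∸ω≡m∸[1+ω∸c] _ _ ω (m≤n⇒m≤1+n numUniversal≤ω)))
      (dim (twinFreeCliqueNumber twins)))
  where
    open RootedProduct G H v G-simple H-simple G-connected (degree≡n⇒universal H H-simple v deg)
    dim : ∀ {τ} → IsTwinFreeCliqueNumber F τ → IsStrongMetricDim X (suc (suc r) * suc s ∸ τ)
    dim = strongMetricDim zero (suc zero) (λ ()) zero
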